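{- Let $D$ be a finite connected digraph with $\chi(D)=5$, not isomorphic to $T_5$, in which every vertex has out-degree at least $2$, such that $D$ contains no copy of $p_4$ and the underlying graph of $D$ contains no $K_5$. Let $D'$ be a $5$-critical subdigraph of $D$. Then $D'$ contains at least one vertex whose out-degree in $D'$ is at least $3$.
   Context: A digraph has no loops and, for any two vertices $x,y$, at most one of the arcs $(x,y),(y,x)$; $\chi$ is the chromatic number of the underlying (unoriented) graph. $T_5$ is the $5$-vertex tournament in which every vertex has in- and out-degree $2$. $p_4$ is the digraph with vertices $x,y,z,v,w$ and arcs $y\to x$, $y\to z$, $v\to z$, $v\to w$; a copy of $H$ in $D$ is the image of an injective arc-preserving map $V(H)\to V(D)$. A subdigraph $D'$ is $5$-critical if $\chi(D')=5$ and $\chi(D'-u)<5$ for every vertex $u$ of $D'$. -}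

module Defs where

open import Data.Nat using (ℕ; zero; suc; _<_; _≥_)
open import Data.Fin using (Fin; zero; suc; _≟_)
open import Data.Fin.Patterns
open import Data.Bool using (Bool; true; false; if_then_else_; T)
open import Data.List using (List; map; allFin)
open import Data.Nat.ListAction using (sum)
open import Data.Product using (Σ; ∃; _×_; _,_)
open import Data.Sum using (_⊎_)
open import Relation.Binary.PropositionalEquality using (_≡_; _≢_)
open import Relation.Nullary using (¬_)
open import Function.Definitions using (Injective; Surjective)

record Digraph (n : ℕ) : Set where
  field
    arc      : Fin n → Fin n → Bool
    loopless : ∀ i → arc i i ≡ false
    oriented : ∀ i j → arc i j ≡ true → arc j i ≡ false
open Digraph public

module _ {n : ℕ} (D : Digraph n) where

  Adj : Fin n → Fin n → Set
  Adj i j = T (arc D i j) ⊎ T (arc D j i)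

  outdeg : Fin n → ℕ
  outdeg i = sum (map (λ j → if arc D i j then 1 else 0) (allFin n))

  data Walk : Fin n → Fin n → Set where
    here : ∀ {i} → Walk i i
    step : ∀ {i j k} → Adj i j → Walk j k → Walk i k

  Connected : Set
  Connected = Fin n × (∀ i j → Walk i j)

  Colorable : ℕ → Set
  Colorable k = Σ (Fin n → Fin k) λ c → ∀ i j → Adj i j → c i ≢ c j

  ChromaticNumber : ℕ → Set
  ChromaticNumber k = Colorable k × (∀ j → j < k → ¬ Colorable j)

  ColorableMinus : Fin n → ℕ → Set
  ColorableMinus u k = Σ (Fin n → Fin k) λ c →
    ∀ i j → i ≢ u → j ≢ u → Adj i j → c i ≢ c j

  -- 5-critical: χ = 5 and χ(D - u) < 5 for every vertex u
  FiveCritical : Set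
  FiveCritical = ChromaticNumber 5 × (∀ u → ColorableMinus u 4)

Iso : ∀ {n m} → Digraph n → Digraph m → Set
Iso {n} {m} D E = Σ (Fin n → Fin m) λ f →
  Injective _≡_ _≡_ f × Surjective _≡_ _≡_ f × (∀ i j → arc D i j ≡ arc E (f i) (f j))

-- D' is (isomorphic to) a subdigraph of D: injective vertex map sending arcs to arcs
Subdigraph : ∀ {m n} → Digraph m → Digraph n → Set
Subdigraph {m} {n} D' D = Σ (Fin m → Fin n) λ e →
  Injective _≡_ _≡_ e × (∀ i j → T (arc D' i j) → T (arc D (e i) (e j)))

-- T5: the regular tournament on 5 vertices, i → i+1, i+2 (mod 5)
t5arc : Fin 5 → Fin 5 → Bool
t5arc 0F 1F = true
t5arc 0F 2F = true
t5arc 1F 2F = true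
t5arc 1F 3F = true
t5arc 2F 3F = true
t5arc 2F 4F = true
t5arc 3F 4F = true
t5arc 3F 0F = true
t5arc 4F 0F = true
t5arc 4F 1F = true
t5arc _  _  = false

t5loop : ∀ i → t5arc i i ≡ false
t5loop 0F = _≡_.refl
t5loop 1F = _≡_.refl
t5loop 2F = _≡_.refl
t5loop 3F = _≡_.refl
t5loop 4F = _≡_.refl

t5or : ∀ i j → t5arc i j ≡ true → t5arc j i ≡ false
t5or 0F 1F _ = _≡_.refl
t5or 0F 2F _ = _≡_.refl
t5or 1F 2F _ = _≡_.refl
t5or 1F 3F _ = _≡_.refl
t5or 2F 3F _ = _≡_.refl
t5or 2F 4F _ = _≡_.refl
t5or 3F 4F _ = _≡_.refl
t5or 3F 0F _ = _≡_.refl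
t5or 4F 0F _ = _≡_.refl
t5or 4F 1F _ = _≡_.refl
t5or 0F 0F ()
t5or 0F 3F ()
t5or 0F 4F ()
t5or 1F 0F ()
t5or 1F 1F ()
t5or 1F 4F ()
t5or 2F 0F ()
t5or 2F 1F ()
t5or 2F 2F ()
t5or 3F 1F ()
t5or 3F 2F ()
t5or 3F 3F ()
t5or 4F 2F ()
t5or 4F 3F ()
t5or 4F 4F ()

T5 : Digraph 5
T5 = record { arc = t5arc ; loopless = t5loop ; oriented = t5or }

-- a copy of p4 (vertices x,y,z,v,w = 0,1,2,3,4; arcs y→x, y→z, v→z, v→w)
HasP4 : ∀ {n} → Digraph n → Set
HasP4 {n} D = Σ (Fin 5 → Fin n) λ f → Injective _≡_ _≡_ f ×
  (T (arc D (f 1F) (f 0F)) × T (arc D (f 1F) (f 2F)) ×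
   T (arc D (f 3F) (f 2F)) × T (arc D (f 3F) (f 4F)))

HasK5 : ∀ {n} → Digraph n → Set
HasK5 {n} D = Σ (Fin 5 → Fin n) λ f → Injective _≡_ _≡_ f ×
  (∀ a b → a ≢ b → Adj D (f a) (f b))

module Submission where

-- If D' had all out-degrees at most 2, it would contain a K5, hence so would D; only the
-- K5-freeness of D is used. In a 4-colouring of D' − u every colour occurs next to u (else
-- u could be coloured), so every vertex has degree at least 4 and in-degree at least 2.
-- Since in-degrees and out-degrees have the same sum, all in-degrees are exactly 2, all
-- degrees 4, and each colour occurs exactly once around u. A Kempe-chain argument as in
-- Brooks' theorem then makes these four neighbours pairwise adjacent: with u they form a K5.

open import Defs
open import Data.Nat using (ℕ; zero; suc; _+_; _∸_; _≤_; _<_; _≥_; _≤?_; _<?_; z≤n; s≤s)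
open import Data.Nat.Properties
open import Data.Fin using (Fin; zero; suc; toℕ; punchIn; punchOut) renaming (_≟_ to _≟ᶠ_; _<_ to _<ᶠ_)
open import Data.Fin.Properties
  using (any?; pigeonhole; toℕ<n; punchIn-punchOut; punchOut-injective)
  renaming (suc-injective to Fin-suc-injective)
open import Data.Fin.Patterns
open import Data.Bool using (Bool; true; false; T; _∨_; if_then_else_)
open import Data.Bool.Properties using (T-≡; T-∨)
open import Data.List using (map; allFin; tabulate)
open import Data.List.Properties using (map-tabulate)
open import Data.Nat.ListAction using () renaming (sum to listSum)
open import Data.Vec.Functional using (updateAt)
open import Data.Vec.Functional.Properties using (updateAt-updates; updateAt-minimal)
open import Data.Product using (Σ; ∃; _×_; _,_; proj₁; proj₂)
open import Data.Sum using (_⊎_; inj₁; inj₂)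
open import Data.Empty using (⊥; ⊥-elim)
open import Relation.Nullary using (¬_; Dec; yes; no)
open import Relation.Nullary.Decidable using (_×-dec_)
open import Relation.Binary.PropositionalEquality
open import Function using (_∘_; const)
open import Function.Bundles using (Equivalence)
open import Function.Definitions using (Injective)
open import Algebra.Properties.CommutativeMonoid.Sum +-0-commutativeMonoid
  using (sum; ∑-comm; ∑-distrib-+; sum-remove; sum-cong-≗)

indicator : Bool → ℕ
indicator b = if b then 1 else 0

count : ∀ {n} → (Fin n → Bool) → ℕ
count b = sum (indicator ∘ b)

listSum-map-allFin : ∀ n (g : Fin n → ℕ) → listSum (map g (allFin n)) ≡ sum g
listSum-map-allFin n g = trans (cong listSum (map-tabulate (λ i → i) g)) (listSum-tabulate n g)
  where
  listSum-tabulate : ∀ n (g : Fin n → ℕ) → listSum (tabulate g) ≡ sum g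
  listSum-tabulate zero    g = refl
  listSum-tabulate (suc n) g = cong (g zero +_) (listSum-tabulate n (g ∘ suc))

count-injection : ∀ {k n} (b : Fin n → Bool) (f : Fin k → Fin n) →
  Injective _≡_ _≡_ f → (∀ x → T (b (f x))) → k ≤ count b
count-injection {zero}          b f _     _      = z≤n
count-injection {suc k} {zero}  b f _     _      with f zero
... | ()
count-injection {suc k} {suc n} b f f-inj inside
  rewrite sum-remove {i = f zero} (indicator ∘ b) | Equivalence.to T-≡ (inside zero)
  = s≤s (count-injection (b ∘ punchIn (f zero)) f′ f′-inj f′-inside)
  where
  f₀≢f₊ : ∀ x → f zero ≢ f (suc x)
  f₀≢f₊ x e with f-inj e
  ... | ()
  f′ : Fin k → Fin n
  f′ x = punchOut (f₀≢f₊ x)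
  f′-inj : Injective _≡_ _≡_ f′
  f′-inj e = Fin-suc-injective (f-inj (punchOut-injective (f₀≢f₊ _) (f₀≢f₊ _) e))
  f′-inside : ∀ x → T (b (punchIn (f zero) (f′ x)))
  f′-inside x rewrite punchIn-punchOut (f₀≢f₊ x) = inside (suc x)

sum-mono-≤ : ∀ {n} {g h : Fin n → ℕ} → (∀ i → g i ≤ h i) → sum g ≤ sum h
sum-mono-≤ {zero}  _   = z≤n
sum-mono-≤ {suc n} g≤h = +-mono-≤ (g≤h zero) (sum-mono-≤ (g≤h ∘ suc))

sum-squeeze : ∀ {n} (g h : Fin n → ℕ) → (∀ i → g i ≤ h i) → sum h ≤ sum g → ∀ i → g i ≡ h i
sum-squeeze g h g≤h Σh≤Σg zero =
  ≤-antisym (g≤h zero) (+-cancelʳ-≤ (sum (g ∘ suc)) (h zero) (g zero)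
    (≤-trans (+-monoʳ-≤ (h zero) (sum-mono-≤ (g≤h ∘ suc))) Σh≤Σg))
sum-squeeze g h g≤h Σh≤Σg (suc i) =
  sum-squeeze (g ∘ suc) (h ∘ suc) (g≤h ∘ suc)
    (+-cancelˡ-≤ (g zero) _ _ (≤-trans (+-monoˡ-≤ (sum (h ∘ suc)) (g≤h zero)) Σh≤Σg)) i

m+n≡o∧n+d≤o⇒d≤m : ∀ {m n o} d → m + n ≡ o → n + d ≤ o → d ≤ m
m+n≡o∧n+d≤o⇒d≤m {m} {n} d e le = +-cancelʳ-≤ n d m (subst₂ _≤_ (+-comm n d) (sym e) le)

m+1+n≡1+o⇒m≤o : ∀ {m n o} → m + suc n ≡ suc o → m ≤ o
m+1+n≡1+o⇒m≤o {m} {n} e = subst (m ≤_) (suc-injective (trans (sym (+-suc m n)) e)) (m≤m+n m n)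

m+n≡o+p∧p<n⇒m<o : ∀ {m n o p} → m + n ≡ o + p → p < n → m < o
m+n≡o+p∧p<n⇒m<o {m} {n} {o} {p} e p<n with m <? o
... | yes m<o = m<o
... | no m≮o  = ⊥-elim (<-irrefl (sym e) (+-mono-≤-< (≮⇒≥ m≮o) p<n))

module _ {n : ℕ} (D : Digraph n) where

  Adj-sym : ∀ {x y} → Adj D x y → Adj D y x
  Adj-sym (inj₁ t) = inj₂ t
  Adj-sym (inj₂ t) = inj₁ t

  Adj-irrefl : ∀ x → ¬ Adj D x x
  Adj-irrefl x (inj₁ t) = subst T (loopless D x) t
  Adj-irrefl x (inj₂ t) = subst T (loopless D x) t

  Adj⇒≢ : ∀ {x y} → Adj D x y → x ≢ y
  Adj⇒≢ a refl = Adj-irrefl _ a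

  Adj? : ∀ x y → Dec (Adj D x y)
  Adj? x y with arc D x y | arc D y x
  ... | true  | _     = yes (inj₁ _)
  ... | false | true  = yes (inj₂ _)
  ... | false | false = no λ { (inj₁ ()) ; (inj₂ ()) }

  indeg : Fin n → ℕ
  indeg v = count (λ w → arc D w v)

  outdeg≡count : ∀ v → outdeg D v ≡ count (arc D v)
  outdeg≡count v = listSum-map-allFin n _

  sum-indeg≡sum-outdeg : sum indeg ≡ sum (outdeg D)
  sum-indeg≡sum-outdeg = begin
    sum indeg                                ≡⟨ ∑-comm (λ v w → indicator (arc D w v)) ⟩
    sum (λ w → count (arc D w))              ≡⟨ sum-cong-≗ (sym ∘ outdeg≡count) ⟩
    sum (outdeg D)                           ∎
    where open ≡-Reasoning

  -- Orientation: at most one of the arcs u→y, y→u, so adjacency is counted exactly once.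
  count-Adj≡outdeg+indeg : ∀ u → count (λ y → arc D u y ∨ arc D y u) ≡ outdeg D u + indeg u
  count-Adj≡outdeg+indeg u = begin
    count (λ y → arc D u y ∨ arc D y u)      ≡⟨ sum-cong-≗ split ⟩
    sum (λ y → indicator (arc D u y) + indicator (arc D y u))
                                             ≡⟨ ∑-distrib-+ (indicator ∘ arc D u) (λ y → indicator (arc D y u)) ⟩
    count (arc D u) + indeg u                ≡⟨ cong (_+ indeg u) (sym (outdeg≡count u)) ⟩
    outdeg D u + indeg u                     ∎
    where
    open ≡-Reasoning
    split : ∀ y → indicator (arc D u y ∨ arc D y u) ≡ indicator (arc D u y) + indicator (arc D y u)
    split y with arc D u y in uy
    ... | true  rewrite oriented D u y uy = refl
    ... | false = refl

  neighbours-bound : ∀ {k} u (f : Fin k → Fin n) → Injective _≡_ _≡_ f →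
    (∀ x → Adj D u (f x)) → k ≤ outdeg D u + indeg u
  neighbours-bound u f f-inj adj = subst (_ ≤_) (count-Adj≡outdeg+indeg u)
    (count-injection _ f f-inj (λ x → Equivalence.from T-∨ (adj x)))

  ProperOff : ∀ {k} → Fin n → (Fin n → Fin k) → Set
  ProperOff u c = ∀ i j → i ≢ u → j ≢ u → Adj D i j → c i ≢ c j

  colour-missing⇒Colorable : ∀ {k u} {c : Fin n → Fin k} → ProperOff u c → ∀ κ →
    (∀ a → Adj D a u → c a ≢ κ) → Colorable D k
  colour-missing⇒Colorable {u = u} {c} pc κ missing = c′ , proper
    where
    c′ = updateAt c u (const κ)
    c′-u : c′ u ≡ κ
    c′-u = updateAt-updates u c
    c′-other : ∀ x → x ≢ u → c′ x ≡ c x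
    c′-other x x≢u = updateAt-minimal x u c x≢u
    proper : ∀ i j → Adj D i j → c′ i ≢ c′ j
    proper i j a with i ≟ᶠ u | j ≟ᶠ u
    ... | yes refl | yes refl = ⊥-elim (Adj-irrefl _ a)
    ... | yes refl | no j≢u = λ e →
      missing j (Adj-sym a) (trans (sym (c′-other j j≢u)) (trans (sym e) c′-u))
    ... | no i≢u | yes refl = λ e →
      missing i a (trans (sym (c′-other i i≢u)) (trans e c′-u))
    ... | no i≢u | no j≢u = λ e →
      pc i j i≢u j≢u a (trans (sym (c′-other i i≢u)) (trans e (c′-other j j≢u)))

  -- h is the uncoloured vertex (the "hole"); it moves to a, and h takes a's colour.
  hole-move : ∀ {k h a κ} {d : Fin n → Fin k} → ProperOff h d → Adj D a h → d a ≡ κ →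
    (∀ {y} → Adj D y h → d y ≡ κ → y ≡ a) → ProperOff a (updateAt d h (const κ))
  hole-move {h = h} {a} {κ} {d} pd ah da unique x y x≢a y≢a xy with x ≟ᶠ h | y ≟ᶠ h
  ... | yes refl | yes refl = ⊥-elim (Adj-irrefl _ xy)
  ... | yes refl | no y≢h = λ e →
    y≢a (unique (Adj-sym xy) (trans (sym (updateAt-minimal y h d y≢h)) (trans (sym e) (updateAt-updates h d))))
  ... | no x≢h | yes refl = λ e →
    x≢a (unique xy (trans (sym (updateAt-minimal x h d x≢h)) (trans e (updateAt-updates h d))))
  ... | no x≢h | no y≢h = λ e →
    pd x y x≢h y≢h xy (trans (sym (updateAt-minimal x h d x≢h)) (trans e (updateAt-minimal y h d y≢h)))

record Rainbow {n : ℕ} (D : Digraph n) : Set where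
  field
    colour-present : ∀ {u} {c : Fin n → Fin 4} → ProperOff D u c →
      ∀ κ → ∃ λ a → Adj D a u × c a ≡ κ
    colour-unique : ∀ {u} {c : Fin n → Fin 4} → ProperOff D u c →
      ∀ {a b} → Adj D a u → Adj D b u → c a ≡ c b → a ≡ b

module _ {n : ℕ} (D : Digraph n) (¬col : ¬ Colorable D 4)
         (critical : ∀ u → ColorableMinus D u 4) (outdeg≤2 : ∀ v → outdeg D v ≤ 2) where

  private
    colour-present : ∀ {u} {c : Fin n → Fin 4} → ProperOff D u c →
      ∀ κ → ∃ λ a → Adj D a u × c a ≡ κ
    colour-present {u} {c} pc κ with any? (λ a → Adj? D a u ×-dec (c a ≟ᶠ κ))
    ... | yes found = found
    ... | no none   = ⊥-elim (¬col (colour-missing⇒Colorable D pc κ λ a au caκ → none (a , au , caκ)))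

    module RainbowNeighbours {u} {c : Fin n → Fin 4} (pc : ProperOff D u c) where
      nbr : Fin 4 → Fin n
      nbr κ = proj₁ (colour-present pc κ)

      nbr-adj : ∀ κ → Adj D (nbr κ) u
      nbr-adj κ = proj₁ (proj₂ (colour-present pc κ))

      nbr-colour : ∀ κ → c (nbr κ) ≡ κ
      nbr-colour κ = proj₂ (proj₂ (colour-present pc κ))

      nbr-injective : Injective _≡_ _≡_ nbr
      nbr-injective {κ} {λ′} e = trans (sym (nbr-colour κ)) (trans (cong c e) (nbr-colour λ′))

    indeg≥2 : ∀ v → 2 ≤ indeg D v
    indeg≥2 v = +-cancelˡ-≤ 2 2 (indeg D v) (≤-trans four≤ (+-monoˡ-≤ (indeg D v) (outdeg≤2 v)))
      where
      open RainbowNeighbours (proj₂ (critical v))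
      four≤ : 4 ≤ outdeg D v + indeg D v
      four≤ = neighbours-bound D v nbr nbr-injective (Adj-sym D ∘ nbr-adj)

    indeg≤2 : ∀ v → indeg D v ≤ 2
    indeg≤2 v = subst (_≤ 2) (sum-squeeze (outdeg D) (indeg D)
      (λ w → ≤-trans (outdeg≤2 w) (indeg≥2 w)) (≤-reflexive (sum-indeg≡sum-outdeg D)) v) (outdeg≤2 v)

    neighbours≤4 : ∀ {k} u (f : Fin k → Fin n) → Injective _≡_ _≡_ f → (∀ x → Adj D u (f x)) → k ≤ 4
    neighbours≤4 u f f-inj adj =
      ≤-trans (neighbours-bound D u f f-inj adj) (+-mono-≤ (outdeg≤2 u) (indeg≤2 u))

    -- Otherwise e and the four rainbow neighbours would be five distinct neighbours of u.
    ≡nbr-of-own-colour : ∀ {u} {c : Fin n → Fin 4} (pc : ProperOff D u c) →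
      ∀ {e} → Adj D e u → e ≡ RainbowNeighbours.nbr pc (c e)
    ≡nbr-of-own-colour {u} {c} pc {e} eu with e ≟ᶠ nbr (c e)
      where open RainbowNeighbours pc
    ... | yes e≡nbr = e≡nbr
    ... | no  e≢nbr = ⊥-elim (<-irrefl refl (neighbours≤4 u f f-inj (Adj-sym D ∘ f-adj)))
      where
      open RainbowNeighbours pc
      e≢nbr-any : ∀ κ → e ≢ nbr κ
      e≢nbr-any κ e≡nbr with κ ≟ᶠ c e
      ... | yes refl = e≢nbr e≡nbr
      ... | no  κ≢ce = κ≢ce (trans (sym (nbr-colour κ)) (cong c (sym e≡nbr)))
      f : Fin 5 → Fin n
      f zero    = e
      f (suc κ) = nbr κ
      f-adj : ∀ x → Adj D (f x) u
      f-adj zero    = eu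
      f-adj (suc κ) = nbr-adj κ
      f-inj : Injective _≡_ _≡_ f
      f-inj {zero}  {zero}   _ = refl
      f-inj {zero}  {suc κ}  p = ⊥-elim (e≢nbr-any κ p)
      f-inj {suc κ} {zero}   p = ⊥-elim (e≢nbr-any κ (sym p))
      f-inj {suc κ} {suc λ′} p = cong suc (nbr-injective p)

    colour-unique : ∀ {u} {c : Fin n → Fin 4} → ProperOff D u c →
      ∀ {a b} → Adj D a u → Adj D b u → c a ≡ c b → a ≡ b
    colour-unique pc au bu ca≡cb =
      trans (≡nbr-of-own-colour pc au) (trans (cong (RainbowNeighbours.nbr pc) ca≡cb) (sym (≡nbr-of-own-colour pc bu)))

  critical⇒rainbow : Rainbow D
  critical⇒rainbow = record { colour-present = colour-present ; colour-unique = colour-unique }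

third-colour : (i j : Fin 4) → i ≢ j → ∃ λ l → i ≢ l × j ≢ l
third-colour 0F 1F _ = 2F , (λ ()) , (λ ())
third-colour 0F 2F _ = 1F , (λ ()) , (λ ())
third-colour 0F 3F _ = 1F , (λ ()) , (λ ())
third-colour 1F 0F _ = 2F , (λ ()) , (λ ())
third-colour 1F 2F _ = 0F , (λ ()) , (λ ())
third-colour 1F 3F _ = 0F , (λ ()) , (λ ())
third-colour 2F 0F _ = 1F , (λ ()) , (λ ())
third-colour 2F 1F _ = 0F , (λ ()) , (λ ())
third-colour 2F 3F _ = 0F , (λ ()) , (λ ())
third-colour 3F 0F _ = 1F , (λ ()) , (λ ())
third-colour 3F 1F _ = 0F , (λ ()) , (λ ())
third-colour 3F 2F _ = 0F , (λ ()) , (λ ())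
third-colour 0F 0F i≢j = ⊥-elim (i≢j refl)
third-colour 1F 1F i≢j = ⊥-elim (i≢j refl)
third-colour 2F 2F i≢j = ⊥-elim (i≢j refl)
third-colour 3F 3F i≢j = ⊥-elim (i≢j refl)

module Kempe {n : ℕ} {D : Digraph n} (rb : Rainbow D) where
  open Rainbow rb

  -- Total on purpose (junk value h), so that walks can be defined before their invariants are proved.
  nbrOfColour : Fin n → (Fin n → Fin 4) → Fin 4 → Fin n
  nbrOfColour h d κ with any? (λ a → Adj? D a h ×-dec (d a ≟ᶠ κ))
  ... | yes (a , _) = a
  ... | no _        = h

  nbrOfColour-spec : ∀ {h d} → ProperOff D h d → ∀ κ →
    Adj D (nbrOfColour h d κ) h × d (nbrOfColour h d κ) ≡ κ
  nbrOfColour-spec {h} {d} pd κ with any? (λ a → Adj? D a h ×-dec (d a ≟ᶠ κ))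
  ... | yes (a , found) = found
  ... | no none         = ⊥-elim (none (colour-present pd κ))

  nbrOfColour-adj : ∀ {h d} → ProperOff D h d → ∀ κ → Adj D (nbrOfColour h d κ) h
  nbrOfColour-adj pd κ = proj₁ (nbrOfColour-spec pd κ)

  nbrOfColour-colour : ∀ {h d} → ProperOff D h d → ∀ κ → d (nbrOfColour h d κ) ≡ κ
  nbrOfColour-colour pd κ = proj₂ (nbrOfColour-spec pd κ)

  nbrOfColour-unique : ∀ {h d} → ProperOff D h d → ∀ {κ y} → Adj D y h → d y ≡ κ → nbrOfColour h d κ ≡ y
  nbrOfColour-unique pd {κ} yh dy =
    colour-unique pd (nbrOfColour-adj pd κ) yh (trans (nbrOfColour-colour pd κ) (sym dy))

  hole-step : ∀ {h d} → ProperOff D h d → ∀ κ →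
    ProperOff D (nbrOfColour h d κ) (updateAt d h (const κ))
  hole-step pd κ = hole-move D pd (nbrOfColour-adj pd κ) (nbrOfColour-colour pd κ)
    (λ yh dy → sym (nbrOfColour-unique pd yh dy))

  -- The hole starts at u and repeatedly moves to its neighbour of colour i, j, i, j, ...,
  -- handing its old position that colour: this traverses the (i, j)-Kempe chain at the neighbour of colour i
  -- while swapping i and j on it.
  module Chain (u : Fin n) (c : Fin n → Fin 4) (pc : ProperOff D u c) (i j : Fin 4) (i≢j : i ≢ j) where

    alt : ℕ → Fin 4
    alt zero          = j
    alt (suc zero)    = i
    alt (suc (suc t)) = alt t

    alt-cases : ∀ t → (alt t ≡ j × alt (suc t) ≡ i) ⊎ (alt t ≡ i × alt (suc t) ≡ j)
    alt-cases zero          = inj₁ (refl , refl)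
    alt-cases (suc zero)    = inj₂ (refl , refl)
    alt-cases (suc (suc t)) = alt-cases t

    alt-i⊎j : ∀ t → alt t ≡ i ⊎ alt t ≡ j
    alt-i⊎j t with alt-cases t
    ... | inj₁ (p , _) = inj₂ p
    ... | inj₂ (p , _) = inj₁ p

    alt-suc-injective : ∀ s t → alt (suc s) ≡ alt (suc t) → alt s ≡ alt t
    alt-suc-injective s t e with alt-cases s | alt-cases t
    ... | inj₁ (p , _) | inj₁ (p′ , _) = trans p (sym p′)
    ... | inj₂ (p , _) | inj₂ (p′ , _) = trans p (sym p′)
    ... | inj₁ (_ , q) | inj₂ (_ , q′) = ⊥-elim (i≢j (trans (sym q) (trans e q′)))
    ... | inj₂ (_ , q) | inj₁ (_ , q′) = ⊥-elim (i≢j (trans (sym q′) (trans (sym e) q)))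

    alt-+-cancelʳ : ∀ s t r → alt (s + r) ≡ alt (t + r) → alt s ≡ alt t
    alt-+-cancelʳ s t zero e = subst₂ (λ p q → alt p ≡ alt q) (+-identityʳ s) (+-identityʳ t) e
    alt-+-cancelʳ s t (suc r) e = alt-+-cancelʳ s t r (alt-suc-injective (s + r) (t + r)
      (subst₂ (λ p q → alt p ≡ alt q) (+-suc s r) (+-suc t r) e))

    state : ℕ → Fin n × (Fin n → Fin 4)
    state zero    = u , c
    state (suc t) = let h = proj₁ (state t) ; d = proj₂ (state t) in
      nbrOfColour h d (alt (suc t)) , updateAt d h (const (alt (suc t)))

    hole : ℕ → Fin n
    hole t = proj₁ (state t)

    colouring : ℕ → Fin n → Fin 4
    colouring t = proj₂ (state t)

    NotReturned : ℕ → Set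
    NotReturned t = ∀ s → suc s < t → hole (suc s) ≢ u

    record Invariant (t : ℕ) : Set where
      field
        proper           : ProperOff D (hole t) (colouring t)
        adjacent         : ∀ s → s < t → Adj D (hole (suc s)) (hole s)
        original-colour  : ∀ s → suc s ≤ t → hole (suc s) ≢ u → c (hole (suc s)) ≡ alt (suc s)
        repeat-is-start  : ∀ r s → r < s → s ≤ t → hole s ≡ hole r → r ≡ 0
        unvisited-kept   : ∀ y → (∀ s → s < t → y ≢ hole s) → colouring t y ≡ c y
        visited-swapped  : ∀ s → s < t → colouring t (hole s) ≡ alt (suc s)

    invariant-zero : Invariant 0
    invariant-zero = record
      { proper = pc ; adjacent = λ _ () ; original-colour = λ _ () ; repeat-is-start = λ { _ .zero () z≤n }
      ; unvisited-kept = λ _ _ → refl ; visited-swapped = λ _ () }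

    NotReturned-pred : ∀ t → NotReturned (suc t) → NotReturned t
    NotReturned-pred t away s lt = away s (m<n⇒m<1+n lt)

    hole≢start : ∀ t → NotReturned (suc t) → 0 < t → hole t ≢ u
    hole≢start (suc t) away _ = away t ≤-refl

    -- The next hole cannot revisit an interior vertex: that vertex and the current hole
    -- would be adjacent and carry the same original colour.
    next-not-revisit : ∀ t → NotReturned (suc t) → Invariant t →
      ∀ r → suc r < t → hole (suc t) ≢ hole (suc r)
    next-not-revisit (suc t) away I r lt e =
      pc (hole (suc r)) (hole (suc t)) (away r (m<n⇒m<1+n lt)) (away t ≤-refl)
         (subst (λ z → Adj D z (hole (suc t))) e (nbrOfColour-adj proper (alt (suc (suc t)))))
         (trans (original-colour r (<⇒≤ lt) (away r (m<n⇒m<1+n lt)))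
           (trans (alt-suc-injective (suc r) (suc t) same-alt)
                  (sym (original-colour t ≤-refl (away t ≤-refl)))))
      where
      open Invariant I
      same-alt : alt (suc (suc r)) ≡ alt (suc (suc t))
      same-alt = trans (sym (visited-swapped (suc r) lt))
        (trans (cong (colouring (suc t)) (sym e)) (nbrOfColour-colour proper (alt (suc (suc t)))))

    module Step (t : ℕ) (away : NotReturned (suc t)) (I : Invariant t) where
      open Invariant I

      next-adj : Adj D (hole (suc t)) (hole t)
      next-adj = nbrOfColour-adj proper (alt (suc t))

      next-new : hole (suc t) ≢ u → ∀ s → s < t → hole (suc t) ≢ hole s
      next-new ≢u zero    _  = ≢u
      next-new ≢u (suc r) lt = next-not-revisit t away I r lt

      adjacent′ : ∀ s → s < suc t → Adj D (hole (suc s)) (hole s)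
      adjacent′ s lt with m≤n⇒m<n∨m≡n (≤-pred lt)
      ... | inj₁ l    = adjacent s l
      ... | inj₂ refl = next-adj

      original-colour′ : ∀ s → suc s ≤ suc t → hole (suc s) ≢ u → c (hole (suc s)) ≡ alt (suc s)
      original-colour′ s le ≢u with m≤n⇒m<n∨m≡n (≤-pred le)
      ... | inj₁ l    = original-colour s l ≢u
      ... | inj₂ refl = trans (sym (unvisited-kept (hole (suc t)) (next-new ≢u)))
                              (nbrOfColour-colour proper (alt (suc t)))

      repeat-is-start′ : ∀ r s → r < s → s ≤ suc t → hole s ≡ hole r → r ≡ 0
      repeat-is-start′ r s lt le e with m≤n⇒m<n∨m≡n le
      ... | inj₁ l = repeat-is-start r s lt (≤-pred l) e
      ... | inj₂ refl with m≤n⇒m<n∨m≡n (≤-pred lt)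
      ...   | inj₂ refl = ⊥-elim (Adj⇒≢ D next-adj e)
      ...   | inj₁ l′ with r
      ...     | zero   = refl
      ...     | suc r′ = ⊥-elim (next-not-revisit t away I r′ l′ e)

      unvisited-kept′ : ∀ y → (∀ s → s < suc t → y ≢ hole s) → colouring (suc t) y ≡ c y
      unvisited-kept′ y new = trans (updateAt-minimal y (hole t) (colouring t) (new t ≤-refl))
                                    (unvisited-kept y (λ s l → new s (m<n⇒m<1+n l)))

      visited-swapped′ : ∀ s → s < suc t → colouring (suc t) (hole s) ≡ alt (suc s)
      visited-swapped′ s lt with m≤n⇒m<n∨m≡n (≤-pred lt)
      ... | inj₂ refl = updateAt-updates (hole t) (colouring t)
      ... | inj₁ l = trans (updateAt-minimal (hole s) (hole t) (colouring t) ≢current) (visited-swapped s l)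
        where
        ≢current : hole s ≢ hole t
        ≢current e with repeat-is-start s t l ≤-refl (sym e)
        ... | refl = hole≢start t away l (sym e)

      invariant-suc : Invariant (suc t)
      invariant-suc = record
        { proper = hole-step proper (alt (suc t)) ; adjacent = adjacent′ ; original-colour = original-colour′
        ; repeat-is-start = repeat-is-start′ ; unvisited-kept = unvisited-kept′ ; visited-swapped = visited-swapped′ }

    invariant : ∀ t → NotReturned t → Invariant t
    invariant zero    _    = invariant-zero
    invariant (suc t) away = Step.invariant-suc t away (invariant t (NotReturned-pred t away))

    first-return-below : ∀ b → (∀ s → s < b → hole (suc s) ≢ u) ⊎
      (∃ λ s₀ → s₀ < b × hole (suc s₀) ≡ u × (∀ s → s < s₀ → hole (suc s) ≢ u))
    first-return-below zero = inj₁ (λ _ ())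
    first-return-below (suc b) with first-return-below b
    ... | inj₂ (s₀ , lt , e , before) = inj₂ (s₀ , m<n⇒m<1+n lt , e , before)
    ... | inj₁ none with hole (suc b) ≟ᶠ u
    ...   | yes e = inj₂ (b , ≤-refl , e , none)
    ...   | no ≢u = inj₁ none′
      where
      none′ : ∀ s → s < suc b → hole (suc s) ≢ u
      none′ s lt with m≤n⇒m<n∨m≡n (≤-pred lt)
      ... | inj₁ l    = none s l
      ... | inj₂ refl = ≢u

    -- Until it returns, the hole never repeats a vertex, so by pigeonhole it is back at u within n steps.
    returns : ∃ λ ℓ → hole (suc ℓ) ≡ u × NotReturned (suc ℓ)
    returns with first-return-below n
    ... | inj₂ (s₀ , _ , e , before) = s₀ , e , λ s lt → before s (≤-pred lt)
    ... | inj₁ none = ⊥-elim (no-repeat (pigeonhole (n<1+n n) (hole ∘ toℕ)))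
      where
      open Invariant (invariant n (λ s lt → none s (≤-pred (m<n⇒m<1+n lt))))
      not-back : ∀ s → 0 < s → s ≤ n → hole s ≢ u
      not-back (suc s) _ le = none s le
      no-repeat : ¬ (∃ λ a → ∃ λ b → a <ᶠ b × hole (toℕ a) ≡ hole (toℕ b))
      no-repeat (a , b , a<b , e) = not-back (toℕ b) (≤-<-trans z≤n a<b) (≤-pred (toℕ<n b))
        (trans (sym e) (cong hole (repeat-is-start (toℕ a) (toℕ b) a<b (≤-pred (toℕ<n b)) (sym e))))

    end : ℕ
    end = proj₁ returns

    back-at-start : hole (suc end) ≡ u
    back-at-start = proj₁ (proj₂ returns)

    away-until-end : ∀ t → t ≤ end → NotReturned (suc t)
    away-until-end t le s lt = proj₂ (proj₂ returns) s (≤-trans lt (s≤s le))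

    interior≢start : ∀ s → suc s ≤ end → hole (suc s) ≢ u
    interior≢start s le = away-until-end end ≤-refl s (s≤s le)

    final : Invariant (suc end)
    final = invariant (suc end) (away-until-end end ≤-refl)

    open Invariant final public using () renaming
      (repeat-is-start to chain-repeat-is-start; unvisited-kept to final-unvisited-kept)

    chain-adj : ∀ s → s ≤ end → Adj D (hole (suc s)) (hole s)
    chain-adj s le = Invariant.adjacent final s (s≤s le)

    interior-colour : ∀ s → suc s ≤ end → c (hole (suc s)) ≡ alt (suc s)
    interior-colour s le = Invariant.original-colour final s (m≤n⇒m≤1+n le) (interior≢start s le)

    final-visited-swapped : ∀ s → s ≤ end → colouring (suc end) (hole s) ≡ alt (suc s)
    final-visited-swapped s le = Invariant.visited-swapped final s (s≤s le)

    final-proper : ProperOff D u (colouring (suc end))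
    final-proper = subst (λ h → ProperOff D h (colouring (suc end))) back-at-start (Invariant.proper final)

    end≢0 : end ≢ 0
    end≢0 e = Adj⇒≢ D (subst (λ t → Adj D (hole (suc t)) (hole t)) e (chain-adj end ≤-refl))
                      (trans (cong (hole ∘ suc) (sym e)) back-at-start)

    -- The hole re-enters u through the colour u received first, namely i.
    alt-suc-end : alt (suc end) ≡ i
    alt-suc-end with end | end≢0 | back-at-start | invariant end (NotReturned-pred end (away-until-end end ≤-refl))
    ... | zero  | ≢0 | _    | _ = ⊥-elim (≢0 refl)
    ... | suc t | _  | back | I =
      trans (sym (nbrOfColour-colour (Invariant.proper I) (alt (suc (suc t)))))
            (trans (cong (colouring (suc t)) back) (Invariant.visited-swapped I 0 (s≤s z≤n)))

    alt-end : alt end ≡ j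
    alt-end = alt-suc-injective end 0 alt-suc-end

    end≥2 : 2 ≤ end
    end≥2 with end | end≢0 | alt-end
    ... | zero        | ≢0 | _ = ⊥-elim (≢0 refl)
    ... | suc zero    | _  | e = ⊥-elim (i≢j e)
    ... | suc (suc _) | _  | _ = s≤s (s≤s z≤n)

    end-adj : Adj D (hole end) u
    end-adj = Adj-sym D (subst (λ z → Adj D z (hole end)) back-at-start (chain-adj end ≤-refl))

    end-colour : c (hole end) ≡ j
    end-colour with end | end≥2 | alt-end | interior-colour
    ... | suc t | _ | e | colour = trans (colour t ≤-refl) e

    -- Colours other than i, j are untouched by the swap, so they stay rainbow around every hole.
    off-chain-colour-unique : ∀ t → NotReturned (suc t) → ∀ {y y′} → Adj D y (hole t) → Adj D y′ (hole t) →
      y ≢ u → y′ ≢ u → c y ≡ c y′ → c y ≢ i → c y ≢ j → y ≡ y′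
    off-chain-colour-unique t away {y} {y′} yh y′h y≢u y′≢u cy≡cy′ ≢i ≢j =
      colour-unique proper yh y′h (trans (kept y y≢u ≢i ≢j)
        (trans cy≡cy′ (sym (kept y′ y′≢u (≢i ∘ trans cy≡cy′) (≢j ∘ trans cy≡cy′)))))
      where
      open Invariant (invariant t (NotReturned-pred t away))
      kept : ∀ z → z ≢ u → c z ≢ i → c z ≢ j → colouring t z ≡ c z
      kept z z≢u ≢i ≢j = unvisited-kept z not-visited
        where
        not-visited : ∀ s → s < t → z ≢ hole s
        not-visited zero    _  e = z≢u e
        not-visited (suc r) lt e with alt-i⊎j (suc r)
        ... | inj₁ ≡i = ≢i (trans (cong c e) (trans (original-colour r (<⇒≤ lt) (away r (m<n⇒m<1+n lt))) ≡i))
        ... | inj₂ ≡j = ≢j (trans (cong c e) (trans (original-colour r (<⇒≤ lt) (away r (m<n⇒m<1+n lt))) ≡j))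

  -- If aᵢ and aⱼ are not adjacent, the (i, j)-chain u aᵢ x … aⱼ u has x ≠ aⱼ. Swapping the
  -- (i, l)-chain at aᵢ recolours aᵢ with l but leaves x and the rest of that (i, j)-chain alone.
  -- Walking the (j, i)-chain back from u then reaches x, where aᵢ and the vertex z found by the
  -- (l, j)-chain at u are two distinct neighbours of colour l.
  module NotAdjacent {u : Fin n} {c : Fin n → Fin 4} (pc : ProperOff D u c) (i j l : Fin 4)
                     (i≢j : i ≢ j) (i≢l : i ≢ l) (j≢l : j ≢ l)
                     (¬adj : ¬ Adj D (nbrOfColour u c i) (nbrOfColour u c j)) where
    module P = Chain u c pc i j i≢j
    module Q = Chain u c pc i l i≢l

    aᵢ = nbrOfColour u c i
    aⱼ = nbrOfColour u c j

    x : Fin n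
    x = P.hole 2

    x-aᵢ : Adj D x aᵢ
    x-aᵢ = P.chain-adj 1 (≤-trans (s≤s z≤n) P.end≥2)

    x≢aⱼ : x ≢ aⱼ
    x≢aⱼ e = ¬adj (Adj-sym D (subst (λ z → Adj D z aᵢ) e x-aᵢ))

    x-colour : c x ≡ j
    x-colour = P.interior-colour 1 P.end≥2

    x≢u : x ≢ u
    x≢u = P.interior≢start 1 P.end≥2

    -- its colour j would make x = aⱼ
    ¬x-u : ¬ Adj D x u
    ¬x-u xu = x≢aⱼ (colour-unique pc xu (nbrOfColour-adj pc j) (trans x-colour (sym (nbrOfColour-colour pc j))))

    P-end≥3 : 3 ≤ P.end
    P-end≥3 = ≤∧≢⇒< P.end≥2 λ e → ¬x-u (subst (λ t → Adj D (P.hole t) u) (sym e) P.end-adj)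

    P-interior≢start : ∀ t → 1 ≤ t → t ≤ P.end → P.hole t ≢ u
    P-interior≢start (suc t) _ le = P.interior≢start t le

    P-interior-colour : ∀ t → 1 ≤ t → t ≤ P.end → c (P.hole t) ≡ P.alt t
    P-interior-colour (suc t) _ le = P.interior-colour t le

    shared-colour-i : ∀ t s → 1 ≤ t → t ≤ P.end → 1 ≤ s → s ≤ Q.end → P.hole t ≡ Q.hole s → Q.alt s ≡ i
    shared-colour-i t (suc s) 1≤t t≤end _ s≤end e = by-cases (P.alt-i⊎j t) (Q.alt-i⊎j (suc s))
      where
      same : P.alt t ≡ Q.alt (suc s)
      same = trans (sym (P-interior-colour t 1≤t t≤end)) (trans (cong c e) (Q.interior-colour s s≤end))
      by-cases : P.alt t ≡ i ⊎ P.alt t ≡ j → Q.alt (suc s) ≡ i ⊎ Q.alt (suc s) ≡ l → Q.alt (suc s) ≡ i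
      by-cases _          (inj₁ ≡i) = ≡i
      by-cases (inj₁ ≡i) (inj₂ ≡l) = ⊥-elim (i≢l (trans (sym ≡i) (trans same ≡l)))
      by-cases (inj₂ ≡j) (inj₂ ≡l) = ⊥-elim (j≢l (trans (sym ≡j) (trans same ≡l)))

    -- A common vertex would have colour i and two distinct Q-neighbours of colour l.
    chains-disjoint : ∀ t s → 2 ≤ t → t ≤ P.end → 1 ≤ s → s ≤ Q.end → P.hole t ≢ Q.hole s
    chains-disjoint (suc t) (suc zero) (s≤s 1≤t) t≤end _ _ e =
      1+n≢0 (P.chain-repeat-is-start 1 (suc t) (s≤s 1≤t) (m≤n⇒m≤1+n t≤end) e)
    chains-disjoint (suc t) (suc (suc s)) 2≤t t≤end 1≤s s≤end e =
      1+n≢0 (Q.chain-repeat-is-start (suc s) (suc (suc (suc s))) (s≤s (n≤1+n _)) (m≤n⇒m≤1+n s+3≤end) (sym y≡y′))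
      where
      ≡i = shared-colour-i (suc t) (suc (suc s)) (≤-trans (s≤s z≤n) 2≤t) t≤end 1≤s s≤end e
      s+3≤end : suc (suc (suc s)) ≤ Q.end
      s+3≤end = ≤∧≢⇒< s≤end λ end≡ → i≢l (trans (sym ≡i) (trans (sym (Q.interior-colour (suc s) s≤end))
                  (subst (λ t → c (Q.hole t) ≡ l) (sym end≡) Q.end-colour)))
      y  = Q.hole (suc s)
      y′ = Q.hole (suc (suc (suc s)))
      y-colour : c y ≡ l
      y-colour with Q.alt-cases (suc s)
      ... | inj₁ (p , _) = trans (Q.interior-colour s (≤-trans (n≤1+n _) s≤end)) p
      ... | inj₂ (_ , q) = ⊥-elim (i≢l (trans (sym ≡i) q))
      y′-colour : c y′ ≡ l
      y′-colour = trans (Q.interior-colour (suc (suc s)) s+3≤end)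
                        (trans (sym (Q.interior-colour s (≤-trans (n≤1+n _) s≤end))) y-colour)
      y≡y′ : y ≡ y′
      y≡y′ = P.off-chain-colour-unique (suc t) (P.away-until-end (suc t) t≤end)
        (subst (Adj D y) (sym e) (Adj-sym D (Q.chain-adj (suc s) (≤-trans (n≤1+n _) s≤end))))
        (subst (Adj D y′) (sym e) (Q.chain-adj (suc (suc s)) s≤end))
        (Q.interior≢start s (≤-trans (n≤1+n _) s≤end)) (Q.interior≢start (suc (suc s)) s+3≤end)
        (trans y-colour (sym y′-colour))
        (λ ≡i′ → i≢l (trans (sym ≡i′) y-colour)) (λ ≡j → j≢l (trans (sym ≡j) y-colour))

    c′ : Fin n → Fin 4
    c′ = Q.colouring (suc Q.end)

    pc′ : ProperOff D u c′
    pc′ = Q.final-proper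

    c′-on-P : ∀ t → 2 ≤ t → t ≤ P.end → c′ (P.hole t) ≡ c (P.hole t)
    c′-on-P t 2≤t t≤end = Q.final-unvisited-kept (P.hole t) not-on-Q
      where
      not-on-Q : ∀ s → s < suc Q.end → P.hole t ≢ Q.hole s
      not-on-Q zero    _  = P-interior≢start t (≤-trans (s≤s z≤n) 2≤t) t≤end
      not-on-Q (suc s) lt = chains-disjoint t (suc s) 2≤t t≤end (s≤s z≤n) (≤-pred lt)

    aᵢ-c′ : c′ aᵢ ≡ l
    aᵢ-c′ = Q.final-visited-swapped 1 (≤-trans (s≤s z≤n) Q.end≥2)

    x-c′ : c′ x ≡ j
    x-c′ = trans (c′-on-P 2 ≤-refl P.end≥2) x-colour

    module R = Chain u c′ pc′ l j (j≢l ∘ sym)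

    R-hole-1 : R.hole 1 ≡ aᵢ
    R-hole-1 = nbrOfColour-unique pc′ (nbrOfColour-adj pc i) aᵢ-c′

    R-hole-2 : R.hole 2 ≡ x
    R-hole-2 = nbrOfColour-unique (R.Invariant.proper (R.invariant 1 λ _ → λ { (s≤s ()) }))
      (subst (Adj D x) (sym R-hole-1) x-aᵢ) (trans (updateAt-minimal x u c′ x≢u) x-c′)

    R-end≥3 : 3 ≤ R.end
    R-end≥3 = ≤∧≢⇒< R.end≥2 λ e → ¬x-u (subst (λ h → Adj D h u) R-hole-2
                                          (subst (λ t → Adj D (R.hole t) u) (sym e) R.end-adj))

    z : Fin n
    z = R.hole 3

    z≢u : z ≢ u
    z≢u = R.interior≢start 2 R-end≥3

    z-c′ : c′ z ≡ l
    z-c′ = R.interior-colour 2 R-end≥3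

    z-x : Adj D z x
    z-x = subst (Adj D z) R-hole-2 (R.chain-adj 2 (≤-trans (n≤1+n 2) R-end≥3))

    z≢aᵢ : z ≢ aᵢ
    z≢aᵢ e = 1+n≢0 (R.chain-repeat-is-start 1 3 (s≤s (s≤s z≤n)) (m≤n⇒m≤1+n R-end≥3) (trans e (sym R-hole-1)))

    module P′ = Chain u c′ pc′ j i (i≢j ∘ sym)

    P′-alt : ∀ r → P′.alt r ≡ P.alt (suc r)
    P′-alt zero          = refl
    P′-alt (suc zero)    = refl
    P′-alt (suc (suc r)) = P′-alt r

    P-alt-odd : ∀ r → P.alt (r + suc r) ≡ i
    P-alt-odd r = subst (λ t → P.alt t ≡ i) (sym (+-suc r r)) (even r)
      where
      even : ∀ r → P.alt (suc (r + r)) ≡ i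
      even zero    = refl
      even (suc r) = subst (λ t → P.alt t ≡ i) (sym (+-suc r r)) (even r)

    N : ℕ
    N = suc P.end

    Retraces : ℕ → Set
    Retraces s = ∀ r k → r ≤ s → k + r ≡ N → P′.hole r ≡ P.hole k

    retraced : ∀ s → s + 2 ≤ N → Retraces s → ∀ r → suc r ≤ s →
      P′.hole (suc r) ≡ P.hole (N ∸ suc r) × 2 ≤ N ∸ suc r × N ∸ suc r ≤ P.end
    retraced s s+2≤N ret r r<s =
      ret (suc r) k r<s k+r≡N , m+n≡o∧n+d≤o⇒d≤m 2 k+r≡N (≤-trans (+-monoˡ-≤ 2 r<s) s+2≤N) ,
      m+1+n≡1+o⇒m≤o k+r≡N
      where
      k = N ∸ suc r
      k+r≡N : k + suc r ≡ N
      k+r≡N = m∸n+n≡m (≤-trans r<s (≤-trans (m≤m+n s 2) s+2≤N))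

    retraced-away : ∀ s → s + 2 ≤ N → Retraces s → P′.NotReturned (suc s)
    retraced-away s s+2≤N ret r lt = on-P (retraced s s+2≤N ret r (≤-pred lt))
      where
      on-P : ∀ {k} → P′.hole (suc r) ≡ P.hole k × 2 ≤ k × k ≤ P.end → P′.hole (suc r) ≢ u
      on-P (same , 2≤k , k≤end) e = P-interior≢start _ (≤-trans (s≤s z≤n) 2≤k) k≤end (trans (sym same) e)

    retraced-avoids : ∀ s → s + 2 ≤ N → Retraces s → ∀ k → k + suc s ≡ N → 2 ≤ k → k ≤ P.end →
      ∀ r → r < s → P.hole k ≢ P′.hole r
    retraced-avoids s s+2≤N ret k e 2≤k k≤end zero    _  = P-interior≢start k (≤-trans (s≤s z≤n) 2≤k) k≤end
    retraced-avoids s s+2≤N ret k e 2≤k k≤end (suc r) lt = later (retraced s s+2≤N ret r (<⇒≤ lt)) k<k′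
      where
      k<k′ : k < N ∸ suc r
      k<k′ = m+n≡o+p∧p<n⇒m<o (trans e (sym (m∸n+n≡m (≤-trans (<⇒≤ lt) (≤-trans (m≤m+n s 2) s+2≤N)))))
               (m≤n⇒m≤1+n lt)
      later : ∀ {k′} → P′.hole (suc r) ≡ P.hole k′ × 2 ≤ k′ × k′ ≤ P.end → k < k′ →
        P.hole k ≢ P′.hole (suc r)
      later (same , _ , k′≤end) k<k′ q = <⇒≢ (≤-trans (s≤s z≤n) 2≤k)
        (sym (P.chain-repeat-is-start k _ k<k′ (m≤n⇒m≤1+n k′≤end) (trans (sym same) (sym q))))

    -- The reverse walk enters P.hole k: it is the neighbour of the current hole P.hole (suc k)
    -- whose (unchanged) colour is the next one the walk asks for.
    retraces-step : ∀ s → s + 2 ≤ N → Retraces s → ∀ k → k + suc s ≡ N → suc s + 2 ≤ N →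
      P′.hole (suc s) ≡ P.hole k
    retraces-step s s+2≤N ret k e s+3≤N =
      trans (cong (λ h → nbrOfColour h (P′.colouring s) (P′.alt (suc s))) current)
            (nbrOfColour-unique proper′ (Adj-sym D (P.chain-adj k k≤end)) colour)
      where
      current : P′.hole s ≡ P.hole (suc k)
      current = ret s (suc k) ≤-refl (trans (sym (+-suc k s)) e)
      2≤k : 2 ≤ k
      2≤k = m+n≡o∧n+d≤o⇒d≤m 2 e s+3≤N
      k≤end : k ≤ P.end
      k≤end = m+1+n≡1+o⇒m≤o e
      I = P′.invariant s (P′.NotReturned-pred s (retraced-away s s+2≤N ret))
      proper′ : ProperOff D (P.hole (suc k)) (P′.colouring s)
      proper′ = subst (λ h → ProperOff D h (P′.colouring s)) current (P′.Invariant.proper I)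
      same-alt : P.alt k ≡ P′.alt (suc s)
      same-alt = trans (P.alt-+-cancelʳ k s (suc s) (trans (cong P.alt e) (trans P.alt-suc-end (sym (P-alt-odd s)))))
                       (sym (P′-alt (suc s)))
      colour : P′.colouring s (P.hole k) ≡ P′.alt (suc s)
      colour = trans (P′.Invariant.unvisited-kept I (P.hole k) (retraced-avoids s s+2≤N ret k e 2≤k k≤end))
                 (trans (c′-on-P k 2≤k k≤end)
                 (trans (P-interior-colour k (≤-trans (s≤s z≤n) 2≤k) k≤end) same-alt))

    retraces : ∀ s → s + 2 ≤ N → Retraces s
    retraces zero    _     .zero k z≤n e =
      sym (trans (cong P.hole (trans (sym (+-identityʳ k)) e)) P.back-at-start)
    retraces (suc s) s+3≤N r k r≤ e with m≤n⇒m<n∨m≡n r≤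
    ... | inj₁ lt   = retraces s s+2≤N r k (≤-pred lt) e
      where s+2≤N = ≤-trans (n≤1+n _) s+3≤N
    ... | inj₂ refl = retraces-step s s+2≤N (retraces s s+2≤N) k e s+3≤N
      where s+2≤N = ≤-trans (n≤1+n _) s+3≤N

    contradiction : ⊥
    contradiction = z≢aᵢ (sym (P′.off-chain-colour-unique s* away {aᵢ} {z} aᵢ-hole z-hole
      (Adj⇒≢ D (nbrOfColour-adj pc i)) z≢u (trans aᵢ-c′ (sym z-c′))
      (λ ≡j → j≢l (trans (sym ≡j) aᵢ-c′)) (λ ≡i → i≢l (trans (sym ≡i) aᵢ-c′))))
      where
      s* = P.end ∸ 1
      2+s*≡N : 2 + s* ≡ N
      2+s*≡N = cong suc (m+[n∸m]≡n (≤-trans (s≤s z≤n) P-end≥3))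
      s*+2≤N : s* + 2 ≤ N
      s*+2≤N = ≤-reflexive (trans (+-comm s* 2) 2+s*≡N)
      P′-at-x : P′.hole s* ≡ x
      P′-at-x = retraces s* s*+2≤N s* 2 ≤-refl 2+s*≡N
      away : P′.NotReturned (suc s*)
      away = retraced-away s* s*+2≤N (retraces s* s*+2≤N)
      aᵢ-hole : Adj D aᵢ (P′.hole s*)
      aᵢ-hole = subst (Adj D aᵢ) (sym P′-at-x) (Adj-sym D x-aᵢ)
      z-hole : Adj D z (P′.hole s*)
      z-hole = subst (Adj D z) (sym P′-at-x) z-x

  rainbow-neighbours-adjacent : ∀ {u} {c : Fin n → Fin 4} → ProperOff D u c → ∀ {i j} → i ≢ j →
    Adj D (nbrOfColour u c i) (nbrOfColour u c j)
  rainbow-neighbours-adjacent {u} {c} pc {i} {j} i≢j with Adj? D (nbrOfColour u c i) (nbrOfColour u c j)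
  ... | yes adj = adj
  ... | no ¬adj = ⊥-elim (NotAdjacent.contradiction pc i j l i≢j i≢l j≢l ¬adj)
    where
    third = third-colour i j i≢j
    l = proj₁ third
    i≢l = proj₁ (proj₂ third)
    j≢l = proj₂ (proj₂ third)

rainbow⇒K5 : ∀ {n} {D : Digraph n} → Rainbow D → ∀ u → ColorableMinus D u 4 → HasK5 D
rainbow⇒K5 {D = D} rb u (c , pc) = f , f-inj , f-adj
  where
  open Kempe rb
  f : Fin 5 → Fin _
  f zero    = u
  f (suc κ) = nbrOfColour u c κ
  f-inj : Injective _≡_ _≡_ f
  f-inj {zero}  {zero}  _ = refl
  f-inj {zero}  {suc κ} e = ⊥-elim (Adj⇒≢ D (nbrOfColour-adj pc κ) (sym e))
  f-inj {suc κ} {zero}  e = ⊥-elim (Adj⇒≢ D (nbrOfColour-adj pc κ) e)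
  f-inj {suc κ} {suc λ′} e =
    cong suc (trans (sym (nbrOfColour-colour pc κ)) (trans (cong c e) (nbrOfColour-colour pc λ′)))
  f-adj : ∀ a b → a ≢ b → Adj D (f a) (f b)
  f-adj zero    zero    a≢b = ⊥-elim (a≢b refl)
  f-adj zero    (suc κ) _   = Adj-sym D (nbrOfColour-adj pc κ)
  f-adj (suc κ) zero    _   = nbrOfColour-adj pc κ
  f-adj (suc κ) (suc λ′) a≢b = rainbow-neighbours-adjacent pc (a≢b ∘ cong suc)

Subdigraph-HasK5 : ∀ {m n} {D′ : Digraph m} {D : Digraph n} → Subdigraph D′ D → HasK5 D′ → HasK5 D
Subdigraph-HasK5 {D′ = D′} {D} (e , e-inj , e-arc) (f , f-inj , f-adj) =
  e ∘ f , f-inj ∘ e-inj , λ a b a≢b → lift (f-adj a b a≢b)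
  where
  lift : ∀ {x y} → Adj D′ x y → Adj D (e x) (e y)
  lift (inj₁ t) = inj₁ (e-arc _ _ t)
  lift (inj₂ t) = inj₂ (e-arc _ _ t)

some-vertex : ∀ {n} (D : Digraph n) → ¬ Colorable D 0 → Fin n
some-vertex {zero}  D ¬col = ⊥-elim (¬col ((λ ()) , λ ()))
some-vertex {suc n} D _    = zero

FiveCritical∧outdeg≤2⇒HasK5 : ∀ {n} (D : Digraph n) → FiveCritical D → (∀ v → outdeg D v ≤ 2) → HasK5 D
FiveCritical∧outdeg≤2⇒HasK5 D ((_ , ¬col<5) , critical) outdeg≤2 =
  rainbow⇒K5 (critical⇒rainbow D (¬col<5 4 ≤-refl) critical outdeg≤2) u (critical u)
  where u = some-vertex D (¬col<5 0 (s≤s z≤n))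

lemma2p7 : ∀ {n m} (D : Digraph n) (D' : Digraph m) →
    Connected D → ChromaticNumber D 5 → ¬ Iso D T5 →
    (∀ v → outdeg D v ≥ 2) → ¬ HasP4 D → ¬ HasK5 D →
    Subdigraph D' D → FiveCritical D' →
    Σ _ λ v → outdeg D' v ≥ 3
lemma2p7 D D' _ _ _ _ _ ¬K5 D'⊆D critical with any? (λ v → 3 ≤? outdeg D' v)
... | yes found = found
... | no none   = ⊥-elim (¬K5 (Subdigraph-HasK5 {D′ = D'} {D} D'⊆D
                    (FiveCritical∧outdeg≤2⇒HasK5 D' critical λ v → ≤-pred (≰⇒> (λ 3≤ → none (v , 3≤))))))
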